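{- Let $n\geq 8$ and let $H$ be a skew-Hadamard matrix of order $n$ of the form $$H=\begin{bmatrix}1 & \mathbf{1}^T\\ -\mathbf{1} & I_{n-1}+A_1-A_2\end{bmatrix},$$ where $A_1,A_2$ are $(n-1)\times(n-1)$ $\{0,1\}$-matrices with $A_1^T=A_2$; set $A_0=I_{n-1}$ and $\mathfrak{X}=\{A_0,A_1,A_2\}$ (a non-symmetric class $2$ association scheme). Define the $(2n-1)\times(2n-1)$ matrix $$B_1=\begin{bmatrix} A_1 & \mathbf{0} & A_0+A_1\\ \mathbf{1}^T & 0 & \mathbf{0}^T\\ A_1 & \mathbf{1} & A_2\end{bmatrix}$$ (blocks of sizes $n-1,1,n-1$), $B_0=I_{2n-1}$, $B_2=B_1^T$, and $\mathfrak{Y}=\{B_0,B_1,B_2\}$. Then $\operatorname{Aut}(\mathfrak{Y})$ is isomorphic to $\operatorname{Aut}(\mathfrak{X})$.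
   Context: A Hadamard matrix of order $n$ is an $n\times n$ $\pm1$-matrix with $HH^T=nI_n$; it is skew if $H-I_n$ is skew-symmetric. $\mathbf{0},\mathbf{1}$ are the all-zero and all-one column vectors of length $n-1$. For a scheme $\mathfrak{Z}=\{C_0,\dots,C_d\}$ of order $N$, $\operatorname{Aut}(\mathfrak{Z})=\{\sigma\in S_N : P_\sigma^TC_iP_\sigma=C_i \text{ for all } i\}$, where $P_\sigma$ is the permutation matrix of $\sigma$. -}

module Defs where

open import Data.Nat using (ℕ; zero; suc; _+_)
open import Data.Integer as ℤ using (ℤ; +_; -_; _-_)
open import Data.Bool using (Bool; true; false; if_then_else_)
open import Data.Fin using (Fin; zero; suc; splitAt; _≟_)
open import Data.Fin.Permutation using (Permutation′; _⟨$⟩ʳ_; _∘ₚ_)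
open import Data.Sum using (_⊎_; inj₁; inj₂)
open import Data.Product using (Σ; _,_; proj₁; proj₂; _×_)
open import Data.List using (List; []; _∷_)
open import Data.List.Relation.Unary.All using (All; []; _∷_)
open import Relation.Nullary.Decidable using (⌊_⌋)
open import Relation.Binary.PropositionalEquality using (_≡_; trans; cong₂)

Mat : Set → ℕ → ℕ → Set
Mat R a b = Fin a → Fin b → R

transpose : ∀ {R a b} → Mat R a b → Mat R b a
transpose M i j = M j i

sumℤ : ∀ {k} → (Fin k → ℤ) → ℤ
sumℤ {zero}  f = + 0
sumℤ {suc k} f = f zero ℤ.+ sumℤ (λ i → f (suc i))

δ : ∀ {k} → Fin k → Fin k → Bool
δ i j = ⌊ i ≟ j ⌋

b2n : Bool → ℕ
b2n true  = 1
b2n false = 0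

b2z : Bool → ℤ
b2z b = + (b2n b)

Iℤ : ∀ k → Mat ℤ k k
Iℤ k i j = b2z (δ i j)

Iℕ : ∀ k → Mat ℕ k k
Iℕ k i j = b2n (δ i j)

IsHadamard : ∀ n → Mat ℤ n n → Set
IsHadamard n H =
  (∀ i j → (H i j ≡ + 1) ⊎ (H i j ≡ - (+ 1)))
  × (∀ i j → sumℤ (λ k → H i k ℤ.* H j k) ≡ (+ n) ℤ.* Iℤ n i j)

IsSkewHadamard : ∀ n → Mat ℤ n n → Set
IsSkewHadamard n H =
  IsHadamard n H
  × (∀ i j → H j i - Iℤ n j i ≡ - (H i j - Iℤ n i j))

Hmat : ∀ m → Mat Bool m m → Mat Bool m m → Mat ℤ (suc m) (suc m)
Hmat m A₁ A₂ zero    zero    = + 1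
Hmat m A₁ A₂ zero    (suc j) = + 1
Hmat m A₁ A₂ (suc i) zero    = - (+ 1)
Hmat m A₁ A₂ (suc i) (suc j) = (Iℤ m i j ℤ.+ b2z (A₁ i j)) - b2z (A₂ i j)

Scheme : ℕ → Set
Scheme N = List (Mat ℕ N N)

-- σ ∈ Aut(𝔷) iff P_σᵀ C P_σ = C for every C ∈ 𝔷, i.e. (entrywise)
-- C (σ i) (σ j) = C i j for all i j.
IsAut : ∀ {N} → Scheme N → Permutation′ N → Set
IsAut Cs σ = All (λ C → ∀ i j → C (σ ⟨$⟩ʳ i) (σ ⟨$⟩ʳ j) ≡ C i j) Cs

Aut : ∀ {N} → Scheme N → Set
Aut {N} Cs = Σ (Permutation′ N) (IsAut Cs)

_≈ᴬ_ : ∀ {N} {Cs : Scheme N} → Aut Cs → Aut Cs → Set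
_≈ᴬ_ {N} (σ , _) (τ , _) = ∀ i → σ ⟨$⟩ʳ i ≡ τ ⟨$⟩ʳ i

isAut-∘ : ∀ {N} (Cs : Scheme N) (σ τ : Permutation′ N) →
          IsAut Cs σ → IsAut Cs τ → IsAut Cs (σ ∘ₚ τ)
isAut-∘ []       σ τ []       []       = []
isAut-∘ (C ∷ Cs) σ τ (p ∷ ps) (q ∷ qs) =
  (λ i j → trans (q (σ ⟨$⟩ʳ i) (σ ⟨$⟩ʳ j)) (p i j)) ∷ isAut-∘ Cs σ τ ps qs

_·ᴬ_ : ∀ {N} {Cs : Scheme N} → Aut Cs → Aut Cs → Aut Cs
_·ᴬ_ {N} {Cs} (σ , p) (τ , q) = (σ ∘ₚ τ) , isAut-∘ Cs σ τ p q

record _≅ᴬ_ {M N} (Xs : Scheme M) (Ys : Scheme N) : Set where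
  field
    to       : Aut Xs → Aut Ys
    from     : Aut Ys → Aut Xs
    to-cong  : ∀ {a b} → a ≈ᴬ b → to a ≈ᴬ to b
    from-cong : ∀ {a b} → a ≈ᴬ b → from a ≈ᴬ from b
    to-hom   : ∀ a b → to (a ·ᴬ b) ≈ᴬ (to a ·ᴬ to b)
    to-from  : ∀ b → to (from b) ≈ᴬ b
    from-to  : ∀ a → from (to a) ≈ᴬ a

-- The schemes 𝔛 = {A₀, A₁, A₂} (order m = n−1) and 𝔜 = {B₀, B₁, B₂}
-- (order 2n−1 = m + (1 + m)).

𝔛 : ∀ m → Mat Bool m m → Mat Bool m m → Scheme m
𝔛 m A₁ A₂ = Iℕ m ∷ (λ i j → b2n (A₁ i j)) ∷ (λ i j → b2n (A₂ i j)) ∷ []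

-- block index: Fin (m + suc m) splits as Fin m (first block),
-- zero of Fin (suc m) (the middle row/column), suc k (third block)
B₁ : ∀ m → Mat Bool m m → Mat Bool m m → Mat ℕ (m + suc m) (m + suc m)
B₁ m A₁ A₂ x y with splitAt m x | splitAt m y
... | inj₁ i       | inj₁ j       = b2n (A₁ i j)
... | inj₁ i       | inj₂ zero    = 0
... | inj₁ i       | inj₂ (suc j) = Iℕ m i j + b2n (A₁ i j)
... | inj₂ zero    | inj₁ j       = 1
... | inj₂ zero    | inj₂ zero    = 0
... | inj₂ zero    | inj₂ (suc j) = 0
... | inj₂ (suc i) | inj₁ j       = b2n (A₁ i j)
... | inj₂ (suc i) | inj₂ zero    = 1
... | inj₂ (suc i) | inj₂ (suc j) = b2n (A₂ i j)

𝔜 : ∀ m → Mat Bool m m → Mat Bool m m → Scheme (m + suc m)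
𝔜 m A₁ A₂ = Iℕ (m + suc m) ∷ B₁ m A₁ A₂ ∷ transpose (B₁ m A₁ A₂) ∷ []

-- Off the diagonal, A₁ is a tournament, and orthogonality of the rows of H gives two facts about it:
-- every vertex beats at least two others (row i against the first row), and in no 3-cycle
-- i → j → p → i do j and p beat the same other vertices (row j against row p).
-- Call a vertex v of the digraph B₁ mirrored if every out-neighbour x of v has an in-neighbour y of v
-- agreeing with x on the whole out-neighbourhood of v.  The centre vertex is mirrored (take x = left j,
-- y = right j), and the two facts rule out every other vertex.  Being mirrored is invariant under
-- automorphisms, so every automorphism of 𝔜 fixes the centre, hence maps its out-neighbours (the left
-- block) and in-neighbours (the right block) to themselves, acting on both by one automorphism of 𝔛.
-- Conversely an automorphism of 𝔛 acts diagonally on the two blocks.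

module Submission where

open import Defs
open import Data.Nat using (ℕ; suc; _≤_)
open import Data.Bool using (Bool)
open import Relation.Binary.PropositionalEquality using (_≡_)

open import Algebra.Bundles using (AbelianGroup)
open import Data.Bool using (true; false; not)
import Data.Bool as Bool
open import Data.Bool.Properties using (¬-not)
open import Data.Empty using (⊥; ⊥-elim)
open import Data.Fin using (Fin; zero; suc; splitAt; join; lift; _↑ˡ_; _↑ʳ_)
open import Data.Fin.Permutation using (Permutation′; permutation; _∘ₚ_; _⟨$⟩ʳ_; _⟨$⟩ˡ_; inverseˡ; inverseʳ)
open import Data.Fin.Properties
  using (any?; suc-injective; splitAt-↑ˡ; splitAt-↑ʳ; join-splitAt; ↑ˡ-injective)
  renaming (_≟_ to _≟ᶠ_)
open import Data.Integer as ℤ using (ℤ; +_; -_; _-_; 0ℤ; 1ℤ; -1ℤ)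
open import Data.Integer.Properties using (*-zeroʳ; *-identityˡ; suc-*; +-0-abelianGroup)
open import Data.Integer.Solver using (module +-*-Solver)
open import Data.List.Relation.Unary.All using (_∷_; [])
open import Data.Nat using (zero; _+_; s≤s; z≤n)
open import Data.Nat.Properties using (m+1+n≢0)
open import Data.Product using (Σ-syntax; ∃-syntax; _,_; proj₁; proj₂; _×_)
open import Data.Sum using (_⊎_; inj₁; inj₂)
import Data.Sum
open import Data.Vec.Functional using (updateAt)
open import Data.Vec.Functional.Properties using (updateAt-updates; updateAt-minimal)
open import Function using (_∘_)
open import Relation.Nullary using (yes; no; ¬_)
open import Relation.Nullary.Decidable using (¬?; _×-dec_)
open import Relation.Binary.PropositionalEquality
  using (_≢_; refl; sym; trans; cong; cong₂; module ≡-Reasoning)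
open import Algebra.Properties.Group (AbelianGroup.group +-0-abelianGroup) using (inverseʳ-unique)

private
  variable
    k m N : ℕ

δ-refl : (i : Fin k) → δ i i ≡ true
δ-refl i with i ≟ᶠ i
... | yes _ = refl
... | no i≢i = ⊥-elim (i≢i refl)

δ-≢ : {i j : Fin k} → i ≢ j → δ i j ≡ false
δ-≢ {i = i} {j} i≢j with i ≟ᶠ j
... | yes i≡j = ⊥-elim (i≢j i≡j)
... | no _ = refl

b2n-injective : ∀ {a b} → b2n a ≡ b2n b → a ≡ b
b2n-injective {true}  {true}  _ = refl
b2n-injective {false} {false} _ = refl

b2n≢0⇒true : ∀ {a} → b2n a ≢ 0 → a ≡ true
b2n≢0⇒true {true}  _ = refl
b2n≢0⇒true {false} a≢0 = ⊥-elim (a≢0 refl)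

entry≢0 : ∀ {x a} → x ≡ b2n a → a ≡ true → x ≢ 0
entry≢0 refl refl ()

entry≢0⇒true : ∀ {x a} → x ≡ b2n a → x ≢ 0 → a ≡ true
entry≢0⇒true refl = b2n≢0⇒true

≡1⇒≢0 : ∀ {x} → x ≡ 1 → x ≢ 0
≡1⇒≢0 refl ()

permutation-preserves-Iℕ : (σ : Permutation′ N) → ∀ i j → Iℕ N (σ ⟨$⟩ʳ i) (σ ⟨$⟩ʳ j) ≡ Iℕ N i j
permutation-preserves-Iℕ σ i j with i ≟ᶠ j
... | yes refl = cong b2n (δ-refl (σ ⟨$⟩ʳ i))
... | no i≢j   = cong b2n (δ-≢ (i≢j ∘ σ-injective))
  where
    σ-injective : ∀ {x y} → σ ⟨$⟩ʳ x ≡ σ ⟨$⟩ʳ y → x ≡ y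
    σ-injective {x} {y} e = trans (sym (inverseˡ σ)) (trans (cong (σ ⟨$⟩ˡ_) e) (inverseˡ σ))

sumℤ-cong : {f g : Fin k → ℤ} → (∀ c → f c ≡ g c) → sumℤ f ≡ sumℤ g
sumℤ-cong {zero}  f≗g = refl
sumℤ-cong {suc k} f≗g = cong₂ ℤ._+_ (f≗g zero) (sumℤ-cong (f≗g ∘ suc))

sumℤ-const : ∀ k a → sumℤ {k} (λ _ → a) ≡ + k ℤ.* a
sumℤ-const zero    a = refl
sumℤ-const (suc k) a = trans (cong (ℤ._+_ a) (sumℤ-const k a)) (sym (suc-* (+ k) a))

sumℤ-agree-off : (f g : Fin k → ℤ) (i : Fin k) → (∀ c → c ≢ i → f c ≡ g c)
               → sumℤ f ≡ sumℤ g ℤ.+ (f i - g i)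
sumℤ-agree-off {suc k} f g zero f≗g =
  trans (cong (ℤ._+_ (f zero)) (sumℤ-cong (λ c → f≗g (suc c) λ ())))
        (solve 3 (λ x s y → x :+ s := (y :+ s) :+ (x :- y)) refl (f zero) (sumℤ (g ∘ suc)) (g zero))
  where open +-*-Solver
sumℤ-agree-off {suc k} f g (suc i) f≗g =
  trans (cong₂ ℤ._+_ (f≗g zero λ ())
                     (sumℤ-agree-off (f ∘ suc) (g ∘ suc) i (λ c c≢i → f≗g (suc c) (c≢i ∘ suc-injective))))
        (solve 3 (λ y s d → y :+ (s :+ d) := (y :+ s) :+ d) refl
               (g zero) (sumℤ (g ∘ suc)) (f (suc i) - g (suc i)))
  where open +-*-Solver

sumℤ-const-off : (f : Fin k → ℤ) {a b : ℤ} (i : Fin k) → f i ≡ b → (∀ c → c ≢ i → f c ≡ a)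
               → sumℤ f ≡ + k ℤ.* a ℤ.+ (b - a)
sumℤ-const-off {k} f {a} i fi≡b f≗a =
  trans (sumℤ-agree-off f (λ _ → a) i f≗a) (cong₂ (λ s x → s ℤ.+ (x - a)) (sumℤ-const k a) fi≡b)

sumℤ-const-off₂ : (f : Fin k → ℤ) {a b b′ : ℤ} {i u : Fin k} → i ≢ u → f i ≡ b → f u ≡ b′
                → (∀ c → c ≢ i → c ≢ u → f c ≡ a)
                → sumℤ f ≡ (+ k ℤ.* a ℤ.+ (b - a)) ℤ.+ (b′ - a)
sumℤ-const-off₂ {k} f {a} {b} {b′} {i} {u} i≢u fi≡b fu≡b′ f≗a =
  begin
    sumℤ f                                    ≡⟨ sumℤ-agree-off f h u f≗h ⟩
    sumℤ h ℤ.+ (f u - h u)                    ≡⟨ cong₂ (λ x y → sumℤ h ℤ.+ (x - y)) fu≡b′ hu≡a ⟩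
    sumℤ h ℤ.+ (b′ - a)                       ≡⟨ cong (λ s → s ℤ.+ (b′ - a)) h-sum ⟩
    (+ k ℤ.* a ℤ.+ (b - a)) ℤ.+ (b′ - a)      ∎
  where
    open ≡-Reasoning
    h : Fin k → ℤ
    h = updateAt (λ _ → a) i (λ _ → b)
    h≗a : ∀ c → c ≢ i → h c ≡ a
    h≗a c c≢i = updateAt-minimal c i _ c≢i
    h-sum : sumℤ h ≡ + k ℤ.* a ℤ.+ (b - a)
    h-sum = sumℤ-const-off h i (updateAt-updates i _) h≗a
    hu≡a : h u ≡ a
    hu≡a = h≗a u (i≢u ∘ sym)
    f≗h : ∀ c → c ≢ u → f c ≡ h c
    f≗h c c≢u with c ≟ᶠ i
    ... | yes refl = trans fi≡b (sym (updateAt-updates i _))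
    ... | no c≢i = trans (f≗a c c≢i c≢u) (sym (h≗a c c≢i))

-- Nothing is asked of the diagonal: the theorem leaves A₁ i i arbitrary (H only sees A₁ i i - A₂ i i).
IsTournament : Mat Bool m m → Set
IsTournament A = ∀ {i j} → i ≢ j → A j i ≡ not (A i j)

tournament-reverse : {A : Mat Bool m m} → IsTournament A
                   → ∀ {i j} → i ≢ j → A i j ≡ true → A j i ≡ false
tournament-reverse tour i≢j Aij≡true = trans (tour i≢j) (cong not Aij≡true)

tournament-asym : {A : Mat Bool m m} → IsTournament A
                → ∀ {i j} → i ≢ j → A i j ≡ true → A j i ≡ true → ⊥
tournament-asym tour i≢j Aij≡true Aji≡true
  with trans (sym Aji≡true) (tournament-reverse tour i≢j Aij≡true)
... | ()

record TransitiveTriple (A : Mat Bool m m) (source : Fin m) : Set where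
  constructor transitive
  field
    middle sink    : Fin m
    source≢middle  : source ≢ middle
    source≢sink    : source ≢ sink
    middle≢sink    : middle ≢ sink
    source→middle  : A source middle ≡ true
    source→sink    : A source sink ≡ true
    middle→sink    : A middle sink ≡ true

transitiveTriple : {A : Mat Bool m m} → IsTournament A → ∀ {i u w}
                 → i ≢ u → i ≢ w → u ≢ w → A i u ≡ true → A i w ≡ true
                 → TransitiveTriple A i
transitiveTriple {A = A} tour {i} {u} {w} i≢u i≢w u≢w i→u i→w with A u w in u→w
... | true  = transitive u w i≢u i≢w u≢w i→u i→w u→w
... | false = transitive w u i≢w i≢u (u≢w ∘ sym) i→w i→u (trans (tour u≢w) (cong not u→w))

NoTwinned3Cycle : Mat Bool m m → Set
NoTwinned3Cycle A = ∀ {i j p} → i ≢ j → j ≢ p → p ≢ i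
                  → A i j ≡ true → A j p ≡ true → A p i ≡ true
                  → ¬ (∀ c → c ≢ i → c ≢ j → c ≢ p → A j c ≡ A p c)

sgn : Bool → ℤ
sgn true  = 1ℤ
sgn false = -1ℤ

sgn-square : ∀ a → sgn a ℤ.* sgn a ≡ 1ℤ
sgn-square true  = refl
sgn-square false = refl

-- These say m ≢ 1 and m ≢ 3; with 7 ≤ m they are refuted by evaluation.

2-m≢1 : 7 ≤ m → + m ℤ.* -1ℤ ℤ.+ (1ℤ - -1ℤ) ≢ 1ℤ
2-m≢1 (s≤s (s≤s (s≤s (s≤s (s≤s (s≤s (s≤s z≤n))))))) ()

4-m≢1 : 7 ≤ m → (+ m ℤ.* -1ℤ ℤ.+ (1ℤ - -1ℤ)) ℤ.+ (1ℤ - -1ℤ) ≢ 1ℤ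
4-m≢1 (s≤s (s≤s (s≤s (s≤s (s≤s (s≤s (s≤s z≤n))))))) ()

m-4≢-1 : 7 ≤ m → (+ m ℤ.* 1ℤ ℤ.+ (-1ℤ - 1ℤ)) ℤ.+ (-1ℤ - 1ℤ) ≢ -1ℤ
m-4≢-1 (s≤s (s≤s (s≤s (s≤s (s≤s (s≤s (s≤s z≤n))))))) ()

module HadamardTournament (A₁ A₂ : Mat Bool m m) (A₂≡A₁ᵀ : ∀ i j → A₂ i j ≡ A₁ j i)
                         (hadamard : IsHadamard (suc m) (Hmat m A₁ A₂)) where

  H : Mat ℤ (suc m) (suc m)
  H = Hmat m A₁ A₂

  row : Fin m → Fin m → ℤ
  row i c = H (suc i) (suc c)

  row-diag : ∀ i → row i i ≡ 1ℤ
  row-diag i = trans (cong₂ (λ d a → (b2z d ℤ.+ b2z (A₁ i i)) - b2z a) (δ-refl i) (A₂≡A₁ᵀ i i))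
                     (1+a-a (A₁ i i))
    where
      1+a-a : ∀ a → (1ℤ ℤ.+ b2z a) - b2z a ≡ 1ℤ
      1+a-a true  = refl
      1+a-a false = refl

  row-offdiag : ∀ {i c} → i ≢ c → row i c ≡ (0ℤ ℤ.+ b2z (A₁ i c)) - b2z (A₁ c i)
  row-offdiag {i} {c} i≢c = cong₂ (λ d a → (b2z d ℤ.+ b2z (A₁ i c)) - b2z a) (δ-≢ i≢c) (A₂≡A₁ᵀ i c)

  tournament : IsTournament A₁
  tournament {i} {j} i≢j =
    unit-difference (A₁ i j) (A₁ j i)
      (Data.Sum.map (trans (sym (row-offdiag i≢j))) (trans (sym (row-offdiag i≢j)))
                    (proj₁ hadamard (suc i) (suc j)))
    where
      unit-difference : ∀ a b → ((0ℤ ℤ.+ b2z a) - b2z b ≡ 1ℤ) ⊎ ((0ℤ ℤ.+ b2z a) - b2z b ≡ -1ℤ)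
                      → b ≡ not a
      unit-difference true  false _ = refl
      unit-difference false true  _ = refl
      unit-difference true  true  (inj₁ ())
      unit-difference true  true  (inj₂ ())
      unit-difference false false (inj₁ ())
      unit-difference false false (inj₂ ())

  row-sgn : ∀ {i c} → i ≢ c → row i c ≡ sgn (A₁ i c)
  row-sgn {i} {c} i≢c =
    trans (row-offdiag i≢c)
          (trans (cong (λ b → (0ℤ ℤ.+ b2z (A₁ i c)) - b2z b) (tournament i≢c)) (difference (A₁ i c)))
    where
      difference : ∀ a → (0ℤ ℤ.+ b2z a) - b2z (not a) ≡ sgn a
      difference true  = refl
      difference false = refl

  row-value : ∀ {i c a} → i ≢ c → A₁ i c ≡ a → row i c ≡ sgn a
  row-value i≢c Aic≡a = trans (row-sgn i≢c) (cong sgn Aic≡a)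

  row-sum : ∀ i → sumℤ (row i) ≡ 1ℤ
  row-sum i = inverseʳ-unique -1ℤ (sumℤ (row i)) (begin
    -1ℤ ℤ.+ sumℤ (row i)
      ≡⟨ cong (ℤ._+_ -1ℤ) (sumℤ-cong (λ c → sym (*-identityˡ (row i c)))) ⟩
    sumℤ (λ k → H zero k ℤ.* H (suc i) k)
      ≡⟨ proj₂ hadamard zero (suc i) ⟩
    + suc m ℤ.* 0ℤ
      ≡⟨ *-zeroʳ (+ suc m) ⟩
    0ℤ ∎)
    where open ≡-Reasoning

  rows-orthogonal : ∀ {j p} → j ≢ p → sumℤ (λ c → row j c ℤ.* row p c) ≡ -1ℤ
  rows-orthogonal {j} {p} j≢p = inverseʳ-unique 1ℤ _ (begin
    sumℤ (λ k → H (suc j) k ℤ.* H (suc p) k) ≡⟨ proj₂ hadamard (suc j) (suc p) ⟩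
    + suc m ℤ.* b2z (δ (suc j) (suc p))     ≡⟨ cong (λ d → + suc m ℤ.* b2z d) (δ-≢ (j≢p ∘ suc-injective)) ⟩
    + suc m ℤ.* 0ℤ                          ≡⟨ *-zeroʳ (+ suc m) ⟩
    0ℤ                                      ∎)
    where open ≡-Reasoning

  transitiveTriples : 7 ≤ m → ∀ i → TransitiveTriple A₁ i
  transitiveTriples 7≤m i with any? (λ u → ¬? (i ≟ᶠ u) ×-dec (A₁ i u Bool.≟ true))
  ... | no ∄u = ⊥-elim (2-m≢1 7≤m (trans (sym row-sum′) (row-sum i)))
    where
      loses : ∀ c → c ≢ i → row i c ≡ -1ℤ
      loses c c≢i = row-value (c≢i ∘ sym) (¬-not λ i→c → ∄u (c , c≢i ∘ sym , i→c))
      row-sum′ : sumℤ (row i) ≡ + m ℤ.* -1ℤ ℤ.+ (1ℤ - -1ℤ)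
      row-sum′ = sumℤ-const-off (row i) i (row-diag i) loses
  ... | yes (u , i≢u , i→u) with any? (λ w → ¬? (i ≟ᶠ w) ×-dec ¬? (u ≟ᶠ w) ×-dec (A₁ i w Bool.≟ true))
  ...   | yes (w , i≢w , u≢w , i→w) = transitiveTriple tournament i≢u i≢w u≢w i→u i→w
  ...   | no ∄w = ⊥-elim (4-m≢1 7≤m (trans (sym row-sum′) (row-sum i)))
    where
      loses : ∀ c → c ≢ i → c ≢ u → row i c ≡ -1ℤ
      loses c c≢i c≢u = row-value (c≢i ∘ sym) (¬-not λ i→c → ∄w (c , c≢i ∘ sym , c≢u ∘ sym , i→c))
      row-sum′ : sumℤ (row i) ≡ (+ m ℤ.* -1ℤ ℤ.+ (1ℤ - -1ℤ)) ℤ.+ (1ℤ - -1ℤ)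
      row-sum′ = sumℤ-const-off₂ (row i) i≢u (row-diag i) (row-value i≢u i→u) loses

  noTwinned3Cycle : 7 ≤ m → NoTwinned3Cycle A₁
  noTwinned3Cycle 7≤m {i} {j} {p} i≢j j≢p p≢i i→j j→p p→i twins =
    m-4≢-1 7≤m (trans (sym (sumℤ-const-off₂ product i≢j product-at-i product-at-j product-elsewhere))
                      (rows-orthogonal j≢p))
    where
      product : Fin m → ℤ
      product c = row j c ℤ.* row p c
      product-at-i : product i ≡ -1ℤ
      product-at-i = cong₂ ℤ._*_ (row-value (i≢j ∘ sym) (tournament-reverse tournament i≢j i→j))
                                 (row-value p≢i p→i)
      product-at-j : product j ≡ -1ℤ
      product-at-j = cong₂ ℤ._*_ (row-diag j)
                                 (row-value (j≢p ∘ sym) (tournament-reverse tournament j≢p j→p))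
      product-elsewhere : ∀ c → c ≢ i → c ≢ j → product c ≡ 1ℤ
      product-elsewhere c c≢i c≢j with c ≟ᶠ p
      ... | yes refl = cong₂ ℤ._*_ (row-value j≢p j→p) (row-diag p)
      ... | no c≢p = trans (cong₂ ℤ._*_ (row-value (c≢j ∘ sym) (twins c c≢i c≢j c≢p))
                                        (row-sgn (c≢p ∘ sym)))
                           (sgn-square (A₁ p c))

Preserves : Mat ℕ N N → Permutation′ N → Set
Preserves M σ = ∀ x y → M (σ ⟨$⟩ʳ x) (σ ⟨$⟩ʳ y) ≡ M x y

Mirrored : Mat ℕ N N → Fin N → Set
Mirrored {N} M v = ∀ x → M v x ≢ 0
                 → Σ[ y ∈ Fin N ] M y v ≢ 0 × (∀ z → M v z ≢ 0 → M x z ≡ M y z)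

module _ {M : Mat ℕ N N} {σ : Permutation′ N} (σ-preserves : Preserves M σ) where

  preserves-shift : ∀ u w → M (σ ⟨$⟩ʳ u) w ≡ M u (σ ⟨$⟩ˡ w)
  preserves-shift u w = trans (cong (M (σ ⟨$⟩ʳ u)) (sym (inverseʳ σ))) (σ-preserves u (σ ⟨$⟩ˡ w))

  mirrored-invariant : ∀ {v} → Mirrored M v → Mirrored M (σ ⟨$⟩ʳ v)
  mirrored-invariant {v} mirrored x σv→x
    with mirrored (σ ⟨$⟩ˡ x) (σv→x ∘ trans (preserves-shift v x))
  ... | y , y→v , agree = σ ⟨$⟩ʳ y , y→v ∘ trans (sym (σ-preserves y v)) , twin
    where
      open ≡-Reasoning
      twin : ∀ z → M (σ ⟨$⟩ʳ v) z ≢ 0 → M x z ≡ M (σ ⟨$⟩ʳ y) z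
      twin z σv→z = begin
        M x z                            ≡⟨ cong (λ u → M u z) (inverseʳ σ) ⟨
        M (σ ⟨$⟩ʳ (σ ⟨$⟩ˡ x)) z          ≡⟨ preserves-shift (σ ⟨$⟩ˡ x) z ⟩
        M (σ ⟨$⟩ˡ x) (σ ⟨$⟩ˡ z)          ≡⟨ agree (σ ⟨$⟩ˡ z) (σv→z ∘ trans (preserves-shift v z)) ⟩
        M y (σ ⟨$⟩ˡ z)                   ≡⟨ preserves-shift y z ⟨
        M (σ ⟨$⟩ʳ y) z                   ∎

module Blocks {m : ℕ} (A₁ A₂ : Mat Bool m m) (A₂≡A₁ᵀ : ∀ i j → A₂ i j ≡ A₁ j i) where

  B : Mat ℕ (m + suc m) (m + suc m)
  B = B₁ m A₁ A₂

  left : Fin m → Fin (m + suc m)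
  left i = i ↑ˡ suc m

  centre : Fin (m + suc m)
  centre = m ↑ʳ zero

  right : Fin m → Fin (m + suc m)
  right i = m ↑ʳ suc i

  data Position : Fin (m + suc m) → Set where
    at-left   : ∀ i → Position (left i)
    at-centre : Position centre
    at-right  : ∀ i → Position (right i)

  position : ∀ x → Position x
  position x with splitAt m x | join-splitAt m (suc m) x
  ... | inj₁ i       | refl = at-left i
  ... | inj₂ zero    | refl = at-centre
  ... | inj₂ (suc i) | refl = at-right i

  left-injective : ∀ {i j} → left i ≡ left j → i ≡ j
  left-injective = ↑ˡ-injective (suc m) _ _

  B-ll : ∀ i j → B (left i) (left j) ≡ b2n (A₁ i j)
  B-ll i j rewrite splitAt-↑ˡ m i (suc m) | splitAt-↑ˡ m j (suc m) = refl

  B-lc : ∀ i → B (left i) centre ≡ 0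
  B-lc i rewrite splitAt-↑ˡ m i (suc m) | splitAt-↑ʳ m (suc m) zero = refl

  B-lr : ∀ i j → B (left i) (right j) ≡ Iℕ m i j + b2n (A₁ i j)
  B-lr i j rewrite splitAt-↑ˡ m i (suc m) | splitAt-↑ʳ m (suc m) (suc j) = refl

  B-cl : ∀ j → B centre (left j) ≡ 1
  B-cl j rewrite splitAt-↑ʳ m (suc m) zero | splitAt-↑ˡ m j (suc m) = refl

  B-cc : B centre centre ≡ 0
  B-cc rewrite splitAt-↑ʳ m (suc m) zero = refl

  B-cr : ∀ j → B centre (right j) ≡ 0
  B-cr j rewrite splitAt-↑ʳ m (suc m) zero | splitAt-↑ʳ m (suc m) (suc j) = refl

  B-rl : ∀ i j → B (right i) (left j) ≡ b2n (A₁ i j)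
  B-rl i j rewrite splitAt-↑ʳ m (suc m) (suc i) | splitAt-↑ˡ m j (suc m) = refl

  B-rc : ∀ i → B (right i) centre ≡ 1
  B-rc i rewrite splitAt-↑ʳ m (suc m) (suc i) | splitAt-↑ʳ m (suc m) zero = refl

  B-rr : ∀ i j → B (right i) (right j) ≡ b2n (A₁ j i)
  B-rr i j rewrite splitAt-↑ʳ m (suc m) (suc i) | splitAt-↑ʳ m (suc m) (suc j) = cong b2n (A₂≡A₁ᵀ i j)

  B-lr-diag≢0 : ∀ i → B (left i) (right i) ≢ 0
  B-lr-diag≢0 i rewrite B-lr i i | δ-refl i = λ ()

  B-lr-offdiag : ∀ {i j} → i ≢ j → B (left i) (right j) ≡ b2n (A₁ i j)
  B-lr-offdiag {i} {j} i≢j rewrite B-lr i j | δ-≢ i≢j = refl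

  B-lr-arc≢0 : ∀ {i j} → A₁ i j ≡ true → B (left i) (right j) ≢ 0
  B-lr-arc≢0 {i} {j} i→j rewrite B-lr i j | i→j = m+1+n≢0 (Iℕ m i j)

  centre-out⇒left : ∀ x → B centre x ≢ 0 → ∃[ j ] x ≡ left j
  centre-out⇒left x c→x with position x
  ... | at-left j  = j , refl
  ... | at-centre  = ⊥-elim (c→x B-cc)
  ... | at-right j = ⊥-elim (c→x (B-cr j))

  centre-in⇒right : ∀ x → B x centre ≢ 0 → ∃[ j ] x ≡ right j
  centre-in⇒right x x→c with position x
  ... | at-left j  = ⊥-elim (x→c (B-lc j))
  ... | at-centre  = ⊥-elim (x→c B-cc)
  ... | at-right j = j , refl

  centre-mirrored : Mirrored B centre
  centre-mirrored x c→x with centre-out⇒left x c→x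
  ... | j , refl = right j , ≡1⇒≢0 (B-rc j) , twin
    where
      twin : ∀ z → B centre z ≢ 0 → B (left j) z ≡ B (right j) z
      twin z c→z with centre-out⇒left z c→z
      ... | l , refl = trans (B-ll j l) (sym (B-rl j l))

  extend : (Fin m → Fin m) → Fin (m + suc m) → Fin (m + suc m)
  extend f = join m (suc m) ∘ Data.Sum.map f (lift 1 f) ∘ splitAt m

  extend-left : ∀ f i → extend f (left i) ≡ left (f i)
  extend-left f i rewrite splitAt-↑ˡ m i (suc m) = refl

  extend-centre : ∀ f → extend f centre ≡ centre
  extend-centre f rewrite splitAt-↑ʳ m (suc m) zero = refl

  extend-right : ∀ f i → extend f (right i) ≡ right (f i)
  extend-right f i rewrite splitAt-↑ʳ m (suc m) (suc i) = refl

  extend-inverse : ∀ f g → (∀ i → g (f i) ≡ i) → ∀ x → extend g (extend f x) ≡ x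
  extend-inverse f g g∘f≗id x with position x
  ... | at-left i  =
    trans (cong (extend g) (extend-left f i)) (trans (extend-left g (f i)) (cong left (g∘f≗id i)))
  ... | at-centre  = trans (cong (extend g) (extend-centre f)) (extend-centre g)
  ... | at-right i =
    trans (cong (extend g) (extend-right f i)) (trans (extend-right g (f i)) (cong right (g∘f≗id i)))

  extendᵖ : Permutation′ m → Permutation′ (m + suc m)
  extendᵖ t = permutation (extend (t ⟨$⟩ʳ_)) (extend (t ⟨$⟩ˡ_))
                          (extend-inverse _ _ (λ _ → inverseʳ t)) (extend-inverse _ _ (λ _ → inverseˡ t))

  extend-preserves : ∀ f → (∀ i j → Iℕ m (f i) (f j) ≡ Iℕ m i j) → (∀ i j → A₁ (f i) (f j) ≡ A₁ i j)
                   → ∀ x y → B (extend f x) (extend f y) ≡ B x y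
  extend-preserves f f-preserves-I f-preserves-A₁ x y with position x | position y
  ... | at-left i  | at-left j  rewrite extend-left f i | extend-left f j | B-ll (f i) (f j) | B-ll i j
                                = cong b2n (f-preserves-A₁ i j)
  ... | at-left i  | at-centre  rewrite extend-left f i | extend-centre f | B-lc (f i) | B-lc i = refl
  ... | at-left i  | at-right j rewrite extend-left f i | extend-right f j | B-lr (f i) (f j) | B-lr i j
                                = cong₂ _+_ (f-preserves-I i j) (cong b2n (f-preserves-A₁ i j))
  ... | at-centre  | at-left j  rewrite extend-centre f | extend-left f j | B-cl (f j) | B-cl j = refl
  ... | at-centre  | at-centre  rewrite extend-centre f = refl
  ... | at-centre  | at-right j rewrite extend-centre f | extend-right f j | B-cr (f j) | B-cr j = refl
  ... | at-right i | at-left j  rewrite extend-right f i | extend-left f j | B-rl (f i) (f j) | B-rl i j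
                                = cong b2n (f-preserves-A₁ i j)
  ... | at-right i | at-centre  rewrite extend-right f i | extend-centre f | B-rc (f i) | B-rc i = refl
  ... | at-right i | at-right j rewrite extend-right f i | extend-right f j | B-rr (f i) (f j) | B-rr i j
                                = cong b2n (f-preserves-A₁ j i)

  extend-cong : ∀ f g → (∀ i → f i ≡ g i) → ∀ x → extend f x ≡ extend g x
  extend-cong f g f≗g x with position x
  ... | at-left i  = trans (extend-left f i) (trans (cong left (f≗g i)) (sym (extend-left g i)))
  ... | at-centre  = trans (extend-centre f) (sym (extend-centre g))
  ... | at-right i = trans (extend-right f i) (trans (cong right (f≗g i)) (sym (extend-right g i)))

  aut𝔜⇒preserves : ∀ σ → IsAut (𝔜 m A₁ A₂) σ → Preserves B σ
  aut𝔜⇒preserves σ (_ ∷ σ-preserves ∷ _) = σ-preserves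

  preserves⇒aut𝔜 : ∀ σ → Preserves B σ → IsAut (𝔜 m A₁ A₂) σ
  preserves⇒aut𝔜 σ σ-preserves =
    permutation-preserves-Iℕ σ ∷ σ-preserves ∷ (λ x y → σ-preserves y x) ∷ []

  aut𝔛⇒preserves-A₁ : ∀ t → IsAut (𝔛 m A₁ A₂) t → ∀ i j → A₁ (t ⟨$⟩ʳ i) (t ⟨$⟩ʳ j) ≡ A₁ i j
  aut𝔛⇒preserves-A₁ t (_ ∷ t-preserves ∷ _) i j = b2n-injective (t-preserves i j)

  preserves-A₁⇒aut𝔛 : ∀ t → (∀ i j → A₁ (t ⟨$⟩ʳ i) (t ⟨$⟩ʳ j) ≡ A₁ i j) → IsAut (𝔛 m A₁ A₂) t
  preserves-A₁⇒aut𝔛 t t-preserves =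
    permutation-preserves-Iℕ t ∷ (λ i j → cong b2n (t-preserves i j))
    ∷ (λ i j → cong b2n (trans (A₂≡A₁ᵀ _ _) (trans (t-preserves j i) (sym (A₂≡A₁ᵀ i j))))) ∷ []

  extendᴬ : Aut (𝔛 m A₁ A₂) → Aut (𝔜 m A₁ A₂)
  extendᴬ (t , t-aut) =
    extendᵖ t , preserves⇒aut𝔜 (extendᵖ t)
                  (extend-preserves (t ⟨$⟩ʳ_) (permutation-preserves-Iℕ t) (aut𝔛⇒preserves-A₁ t t-aut))

  extendᴬ-cong : {a b : Aut (𝔛 m A₁ A₂)} → a ≈ᴬ b → extendᴬ a ≈ᴬ extendᴬ b
  extendᴬ-cong {t , _} {t′ , _} = extend-cong (t ⟨$⟩ʳ_) (t′ ⟨$⟩ʳ_)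

  module Rigidity (tournament : IsTournament A₁)
                  (triples : ∀ i → TransitiveTriple A₁ i)
                  (noTwinned3Cycle : NoTwinned3Cycle A₁) where

    left-not-mirrored : ∀ i → ¬ Mirrored B (left i)
    left-not-mirrored i mirrored with triples i
    ... | transitive j l i≢j i≢l j≢l i→j i→l j→l
      with mirrored (left j) (entry≢0 (B-ll i j) i→j)
    ... | y , y→i , agree with position y
    ...   | at-left p = B-lr-arc≢0 p→i (trans (sym (agree (right i) (B-lr-diag≢0 i))) j↛i)
      where
        p→i : A₁ p i ≡ true
        p→i = entry≢0⇒true (B-ll p i) y→i
        j↛i : B (left j) (right i) ≡ 0
        j↛i = trans (B-lr-offdiag (i≢j ∘ sym)) (cong b2n (tournament-reverse tournament i≢j i→j))
    ...   | at-centre = B-lr-diag≢0 j (trans (agree (right j) (B-lr-arc≢0 i→j)) (B-cr j))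
    ...   | at-right p = tournament-asym tournament p≢l p→l l→p
      where
        p→i : A₁ p i ≡ true
        p→i = entry≢0⇒true (B-rl p i) y→i
        agree-at-l : b2n (A₁ j l) ≡ b2n (A₁ p l)
        agree-at-l = trans (sym (B-ll j l)) (trans (agree (left l) (entry≢0 (B-ll i l) i→l)) (B-rl p l))
        p→l : A₁ p l ≡ true
        p→l = trans (sym (b2n-injective agree-at-l)) j→l
        l→p : A₁ l p ≡ true
        l→p = entry≢0⇒true (B-rr p l) (B-lr-arc≢0 j→l ∘ trans (agree (right l) (B-lr-arc≢0 i→l)))
        p≢l : p ≢ l
        p≢l refl = tournament-asym tournament i≢l i→l p→i

    right-not-mirrored : ∀ i → ¬ Mirrored B (right i)
    right-not-mirrored i mirrored with triples i
    ... | transitive j l i≢j i≢l j≢l i→j i→l j→l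
      with mirrored (left l) (entry≢0 (B-rl i l) i→l)
    ... | y , y→i , agree with position y
    ...   | at-right s = ≡1⇒≢0 (B-rc s) (trans (sym (agree centre (≡1⇒≢0 (B-rc i)))) (B-lc l))
    ...   | at-centre  = y→i (B-cr i)
    ...   | at-left p with p ≟ᶠ i
    ...     | yes refl = tournament-asym tournament (j≢l ∘ sym) l→j j→l
      where
        l→j : A₁ l j ≡ true
        l→j = trans (b2n-injective (trans (sym (B-ll l j))
                                          (trans (agree (left j) (entry≢0 (B-rl i j) i→j)) (B-ll i j))))
                    i→j
    ...     | no p≢i = noTwinned3Cycle i≢l l≢p p≢i i→l l→p p→i twins
      where
        p→i : A₁ p i ≡ true
        p→i = entry≢0⇒true (B-lr-offdiag p≢i) y→i
        l≢p : l ≢ p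
        l≢p refl = tournament-asym tournament i≢l i→l p→i
        l→p : A₁ l p ≡ true
        l→p = entry≢0⇒true (B-lr-offdiag l≢p)
                (B-lr-diag≢0 p ∘ trans (sym (agree (right p) (entry≢0 (B-rr i p) p→i))))
        twins : ∀ c → c ≢ i → c ≢ l → c ≢ p → A₁ l c ≡ A₁ p c
        twins c c≢i c≢l c≢p with A₁ i c in i→c
        ... | true  = b2n-injective (trans (sym (B-ll l c))
                        (trans (agree (left c) (entry≢0 (B-rl i c) i→c)) (B-ll p c)))
        ... | false = b2n-injective (trans (sym (B-lr-offdiag (c≢l ∘ sym)))
                        (trans (agree (right c) (entry≢0 (B-rr i c) c→i)) (B-lr-offdiag (c≢p ∘ sym))))
          where
            c→i : A₁ c i ≡ true
            c→i = trans (tournament (c≢i ∘ sym)) (cong not i→c)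

    mirrored⇒centre : ∀ v → Mirrored B v → v ≡ centre
    mirrored⇒centre v mirrored with position v
    ... | at-left i  = ⊥-elim (left-not-mirrored i mirrored)
    ... | at-centre  = refl
    ... | at-right i = ⊥-elim (right-not-mirrored i mirrored)

    module Restriction (σ : Permutation′ (m + suc m)) (σ-aut : IsAut (𝔜 m A₁ A₂) σ) where

      σ-preserves : Preserves B σ
      σ-preserves = aut𝔜⇒preserves σ σ-aut

      fixes-centre : σ ⟨$⟩ʳ centre ≡ centre
      fixes-centre =
        mirrored⇒centre (σ ⟨$⟩ʳ centre) (mirrored-invariant {M = B} {σ = σ} σ-preserves centre-mirrored)

      centre→σ : ∀ x → B centre (σ ⟨$⟩ʳ x) ≡ B centre x
      centre→σ x = trans (cong (λ c → B c (σ ⟨$⟩ʳ x)) (sym fixes-centre)) (σ-preserves centre x)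

      σ→centre : ∀ x → B (σ ⟨$⟩ʳ x) centre ≡ B x centre
      σ→centre x = trans (cong (B (σ ⟨$⟩ʳ x)) (sym fixes-centre)) (σ-preserves x centre)

      left-image : ∀ i → ∃[ j ] σ ⟨$⟩ʳ left i ≡ left j
      left-image i = centre-out⇒left _ (≡1⇒≢0 (trans (centre→σ (left i)) (B-cl i)))

      restrict : Fin m → Fin m
      restrict i = proj₁ (left-image i)

      restrict-left : ∀ i → σ ⟨$⟩ʳ left i ≡ left (restrict i)
      restrict-left i = proj₂ (left-image i)

      restrict-preserves-A₁ : ∀ i j → A₁ (restrict i) (restrict j) ≡ A₁ i j
      restrict-preserves-A₁ i j = b2n-injective (begin
        b2n (A₁ (restrict i) (restrict j))        ≡⟨ B-ll (restrict i) (restrict j) ⟨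
        B (left (restrict i)) (left (restrict j)) ≡⟨ cong₂ B (restrict-left i) (restrict-left j) ⟨
        B (σ ⟨$⟩ʳ left i) (σ ⟨$⟩ʳ left j)         ≡⟨ σ-preserves (left i) (left j) ⟩
        B (left i) (left j)                       ≡⟨ B-ll i j ⟩
        b2n (A₁ i j)                              ∎)
        where open ≡-Reasoning

      restrict-injective : ∀ {i j} → restrict i ≡ restrict j → i ≡ j
      restrict-injective {i} {j} e = left-injective (begin
        left i                          ≡⟨ inverseˡ σ ⟨
        σ ⟨$⟩ˡ (σ ⟨$⟩ʳ left i)          ≡⟨ cong (σ ⟨$⟩ˡ_) (restrict-left i) ⟩
        σ ⟨$⟩ˡ left (restrict i)        ≡⟨ cong (λ k → σ ⟨$⟩ˡ left k) e ⟩
        σ ⟨$⟩ˡ left (restrict j)        ≡⟨ cong (σ ⟨$⟩ˡ_) (restrict-left j) ⟨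
        σ ⟨$⟩ˡ (σ ⟨$⟩ʳ left j)          ≡⟨ inverseˡ σ ⟩
        left j                          ∎)
        where open ≡-Reasoning

      restrict-surjective : ∀ k → ∃[ l ] restrict l ≡ k
      restrict-surjective k
        with centre-out⇒left (σ ⟨$⟩ˡ left k)
               (≡1⇒≢0 (trans (sym (centre→σ (σ ⟨$⟩ˡ left k)))
                              (trans (cong (B centre) (inverseʳ σ)) (B-cl k))))
      ... | l , σ⁻¹k≡l = l , left-injective (trans (sym (restrict-left l))
                                             (trans (cong (σ ⟨$⟩ʳ_) (sym σ⁻¹k≡l)) (inverseʳ σ)))

      restrict-unique : ∀ {i k} → σ ⟨$⟩ʳ left i ≡ left k → restrict i ≡ k
      restrict-unique {i} σi≡k = left-injective (trans (sym (restrict-left i)) σi≡k)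

      restrictᵖ : Permutation′ m
      restrictᵖ = permutation restrict (proj₁ ∘ restrict-surjective) (proj₂ ∘ restrict-surjective)
                              (λ i → restrict-injective (proj₂ (restrict-surjective (restrict i))))

      restrict-right : ∀ i → σ ⟨$⟩ʳ right i ≡ right (restrict i)
      restrict-right i
        with centre-in⇒right (σ ⟨$⟩ʳ right i) (≡1⇒≢0 (trans (σ→centre (right i)) (B-rc i)))
      ... | k , σi≡k with restrict-surjective k
      ...   | l , refl with i ≟ᶠ l
      ...     | yes refl = σi≡k
      ...     | no i≢l = ⊥-elim (tournament-asym tournament i≢l i→l l→i)
        where
          B-image : ∀ a → B (left (restrict a)) (right (restrict l)) ≡ B (left a) (right i)
          B-image a = trans (cong₂ B (sym (restrict-left a)) (sym σi≡k)) (σ-preserves (left a) (right i))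
          i→l : A₁ i l ≡ true
          i→l = trans (sym (restrict-preserves-A₁ i l))
                      (entry≢0⇒true (B-lr-offdiag (i≢l ∘ restrict-injective))
                                    (B-lr-diag≢0 i ∘ trans (sym (B-image i))))
          l→i : A₁ l i ≡ true
          l→i = entry≢0⇒true (B-lr-offdiag (i≢l ∘ sym)) (B-lr-diag≢0 (restrict l) ∘ trans (B-image l))

      extend-restrict : ∀ x → extend restrict x ≡ σ ⟨$⟩ʳ x
      extend-restrict x with position x
      ... | at-left i  = trans (extend-left restrict i) (sym (restrict-left i))
      ... | at-centre  = trans (extend-centre restrict) (sym fixes-centre)
      ... | at-right i = trans (extend-right restrict i) (sym (restrict-right i))

    restrictᴬ : Aut (𝔜 m A₁ A₂) → Aut (𝔛 m A₁ A₂)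
    restrictᴬ (σ , σ-aut) = restrictᵖ , preserves-A₁⇒aut𝔛 restrictᵖ restrict-preserves-A₁
      where open Restriction σ σ-aut

    open Restriction using (restrict-unique; restrict-left; extend-restrict)

    restrictᴬ-cong : {a b : Aut (𝔜 m A₁ A₂)} → a ≈ᴬ b → restrictᴬ a ≈ᴬ restrictᴬ b
    restrictᴬ-cong {σ , σ-aut} {σ′ , σ′-aut} σ≗σ′ i =
      sym (restrict-unique σ′ σ′-aut (trans (sym (σ≗σ′ (left i))) (restrict-left σ σ-aut i)))

    restrictᴬ-hom : (a b : Aut (𝔜 m A₁ A₂)) → restrictᴬ (a ·ᴬ b) ≈ᴬ (restrictᴬ a ·ᴬ restrictᴬ b)
    restrictᴬ-hom (σ , σ-aut) (σ′ , σ′-aut) i =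
      restrict-unique (σ ∘ₚ σ′) (isAut-∘ (𝔜 m A₁ A₂) σ σ′ σ-aut σ′-aut)
        (trans (cong (σ′ ⟨$⟩ʳ_) (restrict-left σ σ-aut i)) (restrict-left σ′ σ′-aut _))

    restrictᴬ-extendᴬ : (a : Aut (𝔛 m A₁ A₂)) → restrictᴬ (extendᴬ a) ≈ᴬ a
    restrictᴬ-extendᴬ a i = restrict-unique (proj₁ (extendᴬ a)) (proj₂ (extendᴬ a)) (extend-left _ i)

    extendᴬ-restrictᴬ : (a : Aut (𝔜 m A₁ A₂)) → extendᴬ (restrictᴬ a) ≈ᴬ a
    extendᴬ-restrictᴬ (σ , σ-aut) = extend-restrict σ σ-aut

    Aut𝔜≅Aut𝔛 : 𝔜 m A₁ A₂ ≅ᴬ 𝔛 m A₁ A₂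
    Aut𝔜≅Aut𝔛 = record
      { to        = restrictᴬ
      ; from      = extendᴬ
      ; to-cong   = λ {a} {b} → restrictᴬ-cong {a} {b}
      ; from-cong = λ {a} {b} → extendᴬ-cong {a} {b}
      ; to-hom    = restrictᴬ-hom
      ; to-from   = restrictᴬ-extendᴬ
      ; from-to   = extendᴬ-restrictᴬ
      }

-- For this shape of H with A₂ = A₁ᵀ, skewness is automatic; only the Hadamard property is used.
lemma3 : (m : ℕ) → 7 ≤ m → (A₁ A₂ : Mat Bool m m)
       → (∀ i j → A₂ i j ≡ A₁ j i)
       → IsSkewHadamard (suc m) (Hmat m A₁ A₂)
       → 𝔜 m A₁ A₂ ≅ᴬ 𝔛 m A₁ A₂
lemma3 m 7≤m A₁ A₂ A₂≡A₁ᵀ (hadamard , _) =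
  Aut𝔜≅Aut𝔛 tournament (transitiveTriples 7≤m) (noTwinned3Cycle 7≤m)
  where
    open HadamardTournament A₁ A₂ A₂≡A₁ᵀ hadamard
    open Blocks A₁ A₂ A₂≡A₁ᵀ
    open Rigidity
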